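{- For all positive integers $d$, $k$, and $l$ with $k>l$, \[ \gamma(\mathbb{Z}_d,\{k,l\}) \;=\; \left\lceil \frac{d-(\delta-r)}{k+l}\right\rceil, \] where $\delta=\gcd(d,k-l)$ and $r$ is the remainder of $l\left\lceil (d-\delta)/(k+l)\right\rceil$ modulo $\delta$.
   Context: For a subset $A$ of $\mathbb{Z}_d$ and a positive integer $h$, $hA$ denotes the $h$-fold sumset $\{a_1+\cdots+a_h : a_i\in A\}$. For positive integers $k>l$, $A$ is $(k,l)$-sum-free if $kA\cap lA=\emptyset$. An arithmetic progression in $\mathbb{Z}_d$ is a set $\{a+i\cdot b : i=0,1,\dots,m-1\}$ with $m$ a positive integer, $a,b\in\mathbb{Z}_d$ and $m\le d/\gcd(d,b)$ (so it has exactly $m$ elements); when $m=1$ one takes $b=1$. $\gamma(\mathbb{Z}_d,\{k,l\})$ is the maximum size of a $(k,l)$-sum-free arithmetic progression in $\mathbb{Z}_d$ whose common difference $b$ satisfies $\gcd(b,d)=1$ (taken to be $0$ if there is none). -}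

module Defs where

open import Data.Nat using (ℕ; zero; suc; _+_; _*_; _∸_; _≤_; _<_; _%_; _/_)
open import Data.Nat.GCD using (gcd)
open import Data.Fin using (Fin; toℕ)
open import Data.Vec using (Vec; map; sum)
open import Data.Product using (Σ; ∃; _×_)
open import Data.Sum using (_⊎_)
open import Relation.Nullary using (¬_)
open import Relation.Binary.PropositionalEquality using (_≡_)

-- Total versions of remainder and ceiling division (only used with nonzero divisor;
-- the zero-divisor clauses are arbitrary conventions never reached in the theorem).
modN : ℕ → ℕ → ℕ
modN x zero    = x
modN x (suc n) = x % suc n

ceilDiv : ℕ → ℕ → ℕ
ceilDiv x zero    = zero
ceilDiv x (suc n) = (x + n) / suc n

-- Elements of ℤ_d are represented by their canonical representatives in {0,…,d-1}.
-- The i-th term of the progression {a + i·b : i = 0,…,m-1} in ℤ_d.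
apTerm : (d a b m : ℕ) → Fin m → ℕ
apTerm d a b m i = modN (a + toℕ i * b) d

-- x ∈ h A, where A = {a + i·b : i < m} ⊆ ℤ_d : x is a sum of h (not necessarily
-- distinct) elements of A, computed in ℤ_d.
InSumset : (d a b m h : ℕ) → ℕ → Set
InSumset d a b m h x = Σ (Vec (Fin m) h) λ v → x ≡ modN (sum (map (apTerm d a b m) v)) d

SumFree : (d a b m k l : ℕ) → Set
SumFree d a b m k l = ¬ (∃ λ x → InSumset d a b m k x × InSumset d a b m l x)

-- An arithmetic progression in ℤ_d with m elements, first term a, common difference b
-- coprime to d (then d / gcd(d,b) = d, so the condition m ≤ d/gcd(d,b) reads m ≤ d),
-- which is (k,l)-sum-free.
SumFreeCoprimeAP : (d k l m : ℕ) → Set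
SumFreeCoprimeAP d k l m =
  ∃ λ a → ∃ λ b → a < d × b < d × gcd b d ≡ 1 × 1 ≤ m × m ≤ d × SumFree d a b m k l

IsGamma : (d k l n : ℕ) → Set
IsGamma d k l n =
  (n ≡ 0 ⊎ SumFreeCoprimeAP d k l n) × (∀ m → SumFreeCoprimeAP d k l m → m ≤ n)

gammaFormula : (d k l : ℕ) → ℕ
gammaFormula d k l =
  let δ = gcd d (k ∸ l)
      r = modN (l * ceilDiv (d ∸ δ) (k + l)) δ
  in ceilDiv (d ∸ (δ ∸ r)) (k + l)

{-# OPTIONS --safe #-}
-- Let A = {a + i b : i ≤ n} with b invertible mod d. Then lA = {l a + t b : t ≤ l n} and
-- kA = {l a + (c + s) b : s ≤ k n} where c ≡ (k - l) a b⁻¹, so A is (k,l)-sum-free iff l n < c and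
-- c + k n < d; and as a ranges over ℤ_d, c ranges over exactly the multiples of δ. The least multiple
-- of δ above l n is l n + δ - (l n mod δ), so size n + 1 is possible iff (k + l) n < d - δ + (l n mod δ).
-- This holds for every n below n₀ = ⌈(d - δ)/(k + l)⌉ and for none above it, so only the value
-- r = l n₀ mod δ enters the formula.
module Submission where

open import Defs
open import Data.Nat
open import Data.Nat.Properties
open import Data.Nat.DivMod
open import Data.Nat.Divisibility
open import Data.Nat.GCD using (gcd; gcd-GCD; gcd[m,n]∣m; gcd[m,n]∣n; gcd[m,n]≢0; gcd[m,n]≤n; gcd-zeroˡ; module Bézout)
open import Data.Nat.Solver using (module +-*-Solver)
open import Data.Fin using (Fin; toℕ; fromℕ; fromℕ<)
open import Data.Fin.Properties using (toℕ≤pred[n]; toℕ-fromℕ; toℕ-fromℕ<)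
open import Data.Vec using (Vec; []; _∷_; map; sum)
open import Data.Product using (_,_; proj₁; proj₂; ∃; _×_)
open import Data.Sum using (_⊎_; inj₁; inj₂)
open import Data.Empty using (⊥-elim)
open import Function.Bundles using (_⇔_; mk⇔; Equivalence)
open import Function.Construct.Composition using (_⇔-∘_)
open import Function.Construct.Symmetry using (⇔-sym)
open import Relation.Binary.Definitions using (tri<; tri≈; tri>)
open import Relation.Binary.Bundles using (Setoid)
import Relation.Binary.Reasoning.Setoid as SetoidReasoning
open import Level using (0ℓ)
open import Relation.Binary.PropositionalEquality
open import Relation.Nullary using (¬_; yes; no)
open +-*-Solver
open Bézout using (Identity; +-; -+)

module Congruence (D : ℕ) .{{_ : NonZero D}} where

  infix 4 _≈_
  record _≈_ (x y : ℕ) : Set where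
    constructor %≡⇒≈
    field ≈⇒%≡ : x % D ≡ y % D
  open _≈_ public

  ≈-refl : ∀ {x} → x ≈ x
  ≈-refl = %≡⇒≈ refl

  ≈-sym : ∀ {x y} → x ≈ y → y ≈ x
  ≈-sym x≈y = %≡⇒≈ (sym (≈⇒%≡ x≈y))

  ≈-trans : ∀ {x y z} → x ≈ y → y ≈ z → x ≈ z
  ≈-trans x≈y y≈z = %≡⇒≈ (trans (≈⇒%≡ x≈y) (≈⇒%≡ y≈z))

  ≈-setoid : Setoid 0ℓ 0ℓ
  ≈-setoid = record
    { Carrier       = ℕ
    ; _≈_           = _≈_
    ; isEquivalence = record { refl = ≈-refl ; sym = ≈-sym ; trans = ≈-trans }
    }

  module ≈-Reasoning = SetoidReasoning ≈-setoid

  %-≈ : ∀ x → x % D ≈ x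
  %-≈ x = %≡⇒≈ (m%n%n≡m%n x D)

  +-multiple-≈ : ∀ x q → x + q * D ≈ x
  +-multiple-≈ x q = %≡⇒≈ ([m+kn]%n≡m%n x q D)

  +-cong-≈ : ∀ {x x′ y y′} → x ≈ x′ → y ≈ y′ → x + y ≈ x′ + y′
  +-cong-≈ {x} {x′} {y} {y′} x≈x′ y≈y′ = %≡⇒≈ (begin
    (x + y) % D             ≡⟨ %-distribˡ-+ x y D ⟩
    (x % D + y % D) % D     ≡⟨ cong₂ (λ p q → (p + q) % D) (≈⇒%≡ x≈x′) (≈⇒%≡ y≈y′) ⟩
    (x′ % D + y′ % D) % D   ≡⟨ %-distribˡ-+ x′ y′ D ⟨
    (x′ + y′) % D           ∎)
    where open ≡-Reasoning

  *-cong-≈ : ∀ {x x′ y y′} → x ≈ x′ → y ≈ y′ → x * y ≈ x′ * y′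
  *-cong-≈ {x} {x′} {y} {y′} x≈x′ y≈y′ = %≡⇒≈ (begin
    (x * y) % D             ≡⟨ %-distribˡ-* x y D ⟩
    (x % D * (y % D)) % D   ≡⟨ cong₂ (λ p q → (p * q) % D) (≈⇒%≡ x≈x′) (≈⇒%≡ y≈y′) ⟩
    (x′ % D * (y′ % D)) % D ≡⟨ %-distribˡ-* x′ y′ D ⟨
    (x′ * y′) % D           ∎)
    where open ≡-Reasoning

  -- Adding y * pred D to both sides turns the y into a multiple of D.
  +-cancelʳ-≈ : ∀ {x z} y → x + y ≈ z + y → x ≈ z
  +-cancelʳ-≈ {x} {z} y x+y≈z+y = begin
    x                       ≈⟨ +-multiple-≈ x y ⟨
    x + y * D               ≡⟨ absorb x ⟨
    x + y + y * pred D      ≈⟨ +-cong-≈ x+y≈z+y ≈-refl ⟩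
    z + y + y * pred D      ≡⟨ absorb z ⟩
    z + y * D               ≈⟨ +-multiple-≈ z y ⟩
    z                       ∎
    where
    open ≈-Reasoning
    absorb : ∀ u → u + y + y * pred D ≡ u + y * D
    absorb u = trans (+-assoc u y _) (cong (u +_) (trans (sym (*-suc y (pred D))) (cong (y *_) (suc-pred D))))

  ≈⇒≡ : ∀ {x y} → x < D → y < D → x ≈ y → x ≡ y
  ≈⇒≡ x<D y<D x≈y = trans (sym (m<n⇒m%n≡m x<D)) (trans (≈⇒%≡ x≈y) (m<n⇒m%n≡m y<D))

  -- In the second case x * p ≈ - g, and multiplying by pred D ≈ - 1 flips the sign.
  identity⇒inverse : ∀ {g x} → Identity g x D → ∃ λ y → x * y ≈ g
  identity⇒inverse {g} {x} (+- p q g+qD≡px) = p , (begin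
    x * p                   ≡⟨ trans (*-comm x p) (sym g+qD≡px) ⟩
    g + q * D               ≈⟨ +-multiple-≈ g q ⟩
    g                       ∎)
    where open ≈-Reasoning
  identity⇒inverse {g} {x} (-+ p q g+px≡qD) = p * P , x[pP]≈g
    where
    P = pred D
    shifted : x * (p * P) + g * D ≡ g + q * P * D
    shifted = begin
      x * (p * P) + g * D       ≡⟨ cong (λ t → x * (p * P) + g * t) (suc-pred D) ⟨
      x * (p * P) + g * suc P   ≡⟨ solve 4 (λ x p P g → x :* (p :* P) :+ g :* (con 1 :+ P) := g :+ (g :+ p :* x) :* P) refl x p P g ⟩
      g + (g + p * x) * P       ≡⟨ cong (λ t → g + t * P) g+px≡qD ⟩
      g + q * D * P             ≡⟨ cong (g +_) (solve 3 (λ q D P → q :* D :* P := q :* P :* D) refl q D P) ⟩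
      g + q * P * D             ∎
      where open ≡-Reasoning
    x[pP]≈g : x * (p * P) ≈ g
    x[pP]≈g = begin
      x * (p * P)               ≈⟨ +-multiple-≈ (x * (p * P)) g ⟨
      x * (p * P) + g * D       ≡⟨ shifted ⟩
      g + q * P * D             ≈⟨ +-multiple-≈ g (q * P) ⟩
      g                         ∎
      where open ≈-Reasoning

∣n∣m⇒∣m%n : ∀ {δ m} n .{{_ : NonZero n}} → δ ∣ n → δ ∣ m → δ ∣ m % n
∣n∣m⇒∣m%n {δ} {m} n δ∣n δ∣m =
  ∣m+n∣m⇒∣n (subst (δ ∣_) (trans (m≡m%n+[m/n]*n m n) (+-comm (m % n) _)) δ∣m) (∣n⇒∣m*n (m / n) δ∣n)

indexSum : ∀ {m h} → Vec (Fin m) h → ℕ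
indexSum v = sum (map toℕ v)

indexSum-≤ : ∀ {n h} (v : Vec (Fin (suc n)) h) → indexSum v ≤ h * n
indexSum-≤ []      = z≤n
indexSum-≤ (i ∷ v) = +-mono-≤ (toℕ≤pred[n] i) (indexSum-≤ v)

indexSum-surjective : ∀ n h {t} → t ≤ h * n → ∃ λ (v : Vec (Fin (suc n)) h) → indexSum v ≡ t
indexSum-surjective n zero    {zero} _ = [] , refl
indexSum-surjective n (suc h) {t} t≤ with t ≤? n
... | yes t≤n =
  let v , Σv≡0 = indexSum-surjective n h {0} z≤n
  in  fromℕ< (s≤s t≤n) ∷ v , trans (cong₂ _+_ (toℕ-fromℕ< (s≤s t≤n)) Σv≡0) (+-identityʳ t)
... | no t≰n =
  let v , Σv≡t∸n = indexSum-surjective n h (m≤n+o⇒m∸n≤o t n t≤)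
  in  fromℕ n ∷ v , trans (cong₂ _+_ (toℕ-fromℕ n) Σv≡t∸n) (m+[n∸m]≡n (<⇒≤ (≰⇒> t≰n)))

SeparatingMultiple : (δ D k l n : ℕ) → Set
SeparatingMultiple δ D k l n = ∃ λ c → δ ∣ c × l * n < c × c + k * n < D

module _ (d′ : ℕ) where
  private
    D = suc d′
  open Congruence D

  sum-apTerm-≈ : ∀ a b m {h} (v : Vec (Fin m) h) → sum (map (apTerm D a b m) v) ≈ h * a + indexSum v * b
  sum-apTerm-≈ a b m []              = ≈-refl
  sum-apTerm-≈ a b m {suc h} (i ∷ v) = begin
    (a + toℕ i * b) % D + sum (map (apTerm D a b m) v)  ≈⟨ +-cong-≈ (%-≈ (a + toℕ i * b)) (sum-apTerm-≈ a b m v) ⟩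
    a + toℕ i * b + (h * a + indexSum v * b)           ≡⟨ solve 5 (λ a b i h s → a :+ i :* b :+ (h :* a :+ s :* b) := (con 1 :+ h) :* a :+ (i :+ s) :* b)
                                                            refl a b (toℕ i) h (indexSum v) ⟩
    suc h * a + indexSum (i ∷ v) * b                   ∎
    where open ≈-Reasoning

  sumFree⇒noCollision : ∀ {a b n k l s t} → SumFree D a b (suc n) k l →
                        s ≤ k * n → t ≤ l * n → ¬ (k * a + s * b ≈ l * a + t * b)
  sumFree⇒noCollision {a} {b} {n} {k} {l} sf s≤kn t≤ln collision
    with indexSum-surjective n k s≤kn | indexSum-surjective n l t≤ln
  ... | v , refl | w , refl = sf (_ , (v , refl) ,
    (w , ≈⇒%≡ (≈-trans (sum-apTerm-≈ a b (suc n) v) (≈-trans collision (≈-sym (sum-apTerm-≈ a b (suc n) w))))))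

  noCollision⇒sumFree : ∀ {a b n k l} →
                        (∀ {s t} → s ≤ k * n → t ≤ l * n → ¬ (k * a + s * b ≈ l * a + t * b)) →
                        SumFree D a b (suc n) k l
  noCollision⇒sumFree {a} {b} {n} noCollision (x , (v , x≡Σv) , (w , x≡Σw)) =
    noCollision (indexSum-≤ v) (indexSum-≤ w)
      (≈-trans (≈-sym (sum-apTerm-≈ a b (suc n) v)) (≈-trans (%≡⇒≈ (trans (sym x≡Σv) x≡Σw)) (sum-apTerm-≈ a b (suc n) w)))

  -- The collisions used: t = c if c ≤ l n, and c + s = D if D ≤ c + k n.
  sumFree⇒separatingMultiple : ∀ {δ k l a b n} → l ≤ k → δ ∣ D → δ ∣ k ∸ l → gcd b D ≡ 1 →
                               SumFree D a b (suc n) k l → SeparatingMultiple δ D k l n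
  sumFree⇒separatingMultiple {δ} {k} {l} {a} {b} {n} l≤k δ∣D δ∣k∸l gcd≡1 sf = c , δ∣c , ln<c , c+kn<D
    where
    inverse = identity⇒inverse (subst (λ g → Identity g b D) gcd≡1 (Bézout.identity (gcd-GCD b D)))
    b⁻¹ = proj₁ inverse
    c = ((k ∸ l) * a * b⁻¹) % D
    δ∣c : δ ∣ c
    δ∣c = ∣n∣m⇒∣m%n D δ∣D (∣m⇒∣m*n b⁻¹ (∣m⇒∣m*n a δ∣k∸l))
    c<D : c < D
    c<D = m%n<n ((k ∸ l) * a * b⁻¹) D
    la+cb≈ka : l * a + c * b ≈ k * a
    la+cb≈ka = begin
      l * a + c * b                       ≈⟨ +-cong-≈ ≈-refl (*-cong-≈ (%-≈ ((k ∸ l) * a * b⁻¹)) ≈-refl) ⟩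
      l * a + (k ∸ l) * a * b⁻¹ * b       ≡⟨ cong (l * a +_) (solve 3 (λ x y z → x :* y :* z := z :* y :* x) refl ((k ∸ l) * a) b⁻¹ b) ⟩
      l * a + b * b⁻¹ * ((k ∸ l) * a)     ≈⟨ +-cong-≈ ≈-refl (*-cong-≈ (proj₂ inverse) ≈-refl) ⟩
      l * a + 1 * ((k ∸ l) * a)           ≡⟨ cong (l * a +_) (*-identityˡ ((k ∸ l) * a)) ⟩
      l * a + (k ∸ l) * a                 ≡⟨ trans (sym (*-distribʳ-+ a l (k ∸ l))) (cong (_* a) (m+[n∸m]≡n l≤k)) ⟩
      k * a                               ∎
      where open ≈-Reasoning
    ln<c : l * n < c
    ln<c with l * n <? c
    ... | yes ln<c = ln<c
    ... | no ln≮c = ⊥-elim (sumFree⇒noCollision sf z≤n (≮⇒≥ ln≮c)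
                             (≈-trans (%≡⇒≈ (cong (_% D) (+-identityʳ (k * a)))) (≈-sym la+cb≈ka)))
    wrapAround : k * a + (D ∸ c) * b + c * b ≈ l * a + 0 * b + c * b
    wrapAround = begin
      k * a + (D ∸ c) * b + c * b   ≡⟨ +-assoc (k * a) _ _ ⟩
      k * a + ((D ∸ c) * b + c * b) ≡⟨ cong (k * a +_) (*-distribʳ-+ b (D ∸ c) c) ⟨
      k * a + (D ∸ c + c) * b       ≡⟨ cong (λ t → k * a + t * b) (m∸n+n≡m (<⇒≤ c<D)) ⟩
      k * a + D * b                 ≡⟨ cong (k * a +_) (*-comm D b) ⟩
      k * a + b * D                 ≈⟨ +-multiple-≈ (k * a) b ⟩
      k * a                         ≈⟨ la+cb≈ka ⟨
      l * a + c * b                 ≡⟨ cong (_+ c * b) (+-identityʳ (l * a)) ⟨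
      l * a + 0 * b + c * b         ∎
      where open ≈-Reasoning
    c+kn<D : c + k * n < D
    c+kn<D with c + k * n <? D
    ... | yes c+kn<D = c+kn<D
    ... | no c+kn≮D = ⊥-elim (sumFree⇒noCollision sf (m≤n+o⇒m∸n≤o D c (≮⇒≥ c+kn≮D)) z≤n
                                (+-cancelʳ-≈ (c * b) wrapAround))

  -- Witness: b = 1 and a with (k - l) a ≈ c, which exists because δ ∣ c.
  separatingMultiple⇒sumFreeCoprimeAP : ∀ {δ k l n} → l < k → Identity δ (k ∸ l) D →
                                        SeparatingMultiple δ D k l n → SumFreeCoprimeAP D k l (suc n)
  separatingMultiple⇒sumFreeCoprimeAP {δ} {k} {l} {n} l<k idδ (c , divides w c≡wδ , ln<c , c+kn<D) =
    a , 1 , m%n<n (y * w) D , ≤-<-trans 1≤c c<D , gcd-zeroˡ D , s≤s z≤n , 1+n≤D ,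
    noCollision⇒sumFree noCollision
    where
    inverse = identity⇒inverse idδ
    y = proj₁ inverse
    a = (y * w) % D
    c<D : c < D
    c<D = ≤-<-trans (m≤m+n c (k * n)) c+kn<D
    1≤c : 1 ≤ c
    1≤c = ≤-<-trans z≤n ln<c
    1+n≤D : suc n ≤ D
    1+n≤D = <⇒≤ (≤-<-trans (+-mono-≤ 1≤c (m≤n*m n k {{>-nonZero (≤-<-trans z≤n l<k)}})) c+kn<D)
    [k∸l]a≈c : (k ∸ l) * a ≈ c
    [k∸l]a≈c = begin
      (k ∸ l) * a              ≈⟨ *-cong-≈ (≈-refl {k ∸ l}) (%-≈ (y * w)) ⟩
      (k ∸ l) * (y * w)        ≡⟨ *-assoc (k ∸ l) y w ⟨
      (k ∸ l) * y * w          ≈⟨ *-cong-≈ (proj₂ inverse) ≈-refl ⟩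
      δ * w                    ≡⟨ trans (*-comm δ w) (sym c≡wδ) ⟩
      c                        ∎
      where open ≈-Reasoning
    noCollision : ∀ {s t} → s ≤ k * n → t ≤ l * n → ¬ (k * a + s * 1 ≈ l * a + t * 1)
    noCollision {s} {t} s≤kn t≤ln collision =
      <-irrefl (sym c+s≡t) (<-≤-trans (≤-<-trans t≤ln ln<c) (m≤m+n c s))
      where
      c+s≈t : c + s ≈ t
      c+s≈t = begin
        c + s                     ≈⟨ +-cong-≈ [k∸l]a≈c ≈-refl ⟨
        (k ∸ l) * a + s           ≈⟨ +-cancelʳ-≈ (l * a) (begin
          (k ∸ l) * a + s + l * a   ≡⟨ solve 4 (λ x y z s → x :* y :+ s :+ z :* y := (z :+ x) :* y :+ s :* con 1) refl (k ∸ l) a l s ⟩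
          (l + (k ∸ l)) * a + s * 1 ≡⟨ cong (λ t → t * a + s * 1) (m+[n∸m]≡n (<⇒≤ l<k)) ⟩
          k * a + s * 1             ≈⟨ collision ⟩
          l * a + t * 1             ≡⟨ solve 3 (λ x y t → x :* y :+ t :* con 1 := t :+ x :* y) refl l a t ⟩
          t + l * a                 ∎) ⟩
        t                         ∎
        where open ≈-Reasoning
      c+s≡t : c + s ≡ t
      c+s≡t = ≈⇒≡ (≤-<-trans (+-monoʳ-≤ c s≤kn) c+kn<D) (≤-<-trans t≤ln (<-trans ln<c c<D)) c+s≈t

separatingMultiple⇔ : ∀ δ .{{_ : NonZero δ}} D k l n → δ ≤ D →
                      SeparatingMultiple δ D k l n ⇔ (k + l) * n < D ∸ δ + (l * n) % δ
separatingMultiple⇔ δ D k l n δ≤D = mk⇔ to from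
  where
  ρ = (l * n) % δ
  u = (l * n) / δ
  ln≡ρ+uδ : l * n ≡ ρ + u * δ
  ln≡ρ+uδ = m≡m%n+[m/n]*n (l * n) δ
  next : (k + l) * n + δ ≡ ρ + (suc u * δ + k * n)
  next = begin
    (k + l) * n + δ          ≡⟨ solve 4 (λ k l n d → (k :+ l) :* n :+ d := l :* n :+ (d :+ k :* n)) refl k l n δ ⟩
    l * n + (δ + k * n)      ≡⟨ cong (_+ (δ + k * n)) ln≡ρ+uδ ⟩
    ρ + u * δ + (δ + k * n)  ≡⟨ solve 4 (λ r u d x → r :+ u :* d :+ (d :+ x) := r :+ ((con 1 :+ u) :* d :+ x)) refl ρ u δ (k * n) ⟩
    ρ + (suc u * δ + k * n)  ∎
    where open ≡-Reasoning
  D+ρ≡ : D + ρ ≡ D ∸ δ + ρ + δ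
  D+ρ≡ = trans (cong (_+ ρ) (sym (m∸n+n≡m δ≤D))) (solve 3 (λ e d r → e :+ d :+ r := e :+ r :+ d) refl (D ∸ δ) δ ρ)

  to : SeparatingMultiple δ D k l n → (k + l) * n < D ∸ δ + ρ
  to (c , divides q c≡qδ , ln<c , c+kn<D) = +-cancelʳ-< δ _ _ (begin-strict
    (k + l) * n + δ          ≡⟨ next ⟩
    ρ + (suc u * δ + k * n)  ≤⟨ +-monoʳ-≤ ρ (+-monoˡ-≤ (k * n) [1+u]δ≤c) ⟩
    ρ + (c + k * n)          <⟨ +-monoʳ-< ρ c+kn<D ⟩
    ρ + D                    ≡⟨ trans (+-comm ρ D) D+ρ≡ ⟩
    D ∸ δ + ρ + δ            ∎)
    where
    open ≤-Reasoning
    uδ<qδ : u * δ < q * δ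
    uδ<qδ = begin-strict
      u * δ      ≤⟨ m≤n+m (u * δ) ρ ⟩
      ρ + u * δ  ≡⟨ ln≡ρ+uδ ⟨
      l * n      <⟨ ln<c ⟩
      c          ≡⟨ c≡qδ ⟩
      q * δ      ∎
    [1+u]δ≤c : suc u * δ ≤ c
    [1+u]δ≤c = begin
      suc u * δ  ≤⟨ *-monoˡ-≤ δ (*-cancelʳ-< δ u q uδ<qδ) ⟩
      q * δ      ≡⟨ c≡qδ ⟨
      c          ∎

  from : (k + l) * n < D ∸ δ + ρ → SeparatingMultiple δ D k l n
  from bound = suc u * δ , divides (suc u) refl , ln<[1+u]δ , +-cancelˡ-< ρ _ _ (begin-strict
    ρ + (suc u * δ + k * n)  ≡⟨ next ⟨
    (k + l) * n + δ          <⟨ +-monoˡ-< δ bound ⟩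
    D ∸ δ + ρ + δ            ≡⟨ trans (+-comm ρ D) D+ρ≡ ⟨
    ρ + D                    ∎)
    where
    open ≤-Reasoning
    ln<[1+u]δ : l * n < suc u * δ
    ln<[1+u]δ = begin-strict
      l * n      ≡⟨ ln≡ρ+uδ ⟩
      ρ + u * δ  <⟨ +-monoˡ-< (u * δ) (m%n<n (l * n) δ) ⟩
      δ + u * δ  ∎

<-ceilDiv⇔ : ∀ N′ x n → n < ceilDiv x (suc N′) ⇔ suc N′ * n < x
<-ceilDiv⇔ N′ x n = mk⇔ to from
  where
  N = suc N′
  open ≤-Reasoning
  from : N * n < x → n < ceilDiv x N
  from Nn<x = begin
    suc n          ≡⟨ m*n/n≡m (suc n) N ⟨
    suc n * N / N  ≤⟨ /-monoˡ-≤ N (begin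
      suc n * N        ≡⟨ solve 2 (λ n a → (con 1 :+ n) :* (con 1 :+ a) := (con 1 :+ (con 1 :+ a) :* n) :+ a) refl n N′ ⟩
      suc (N * n) + N′ ≤⟨ +-monoˡ-≤ N′ Nn<x ⟩
      x + N′           ∎) ⟩
    (x + N′) / N   ∎
  to : n < ceilDiv x N → N * n < x
  to n<⌈x/N⌉ with N * n <? x
  ... | yes Nn<x = Nn<x
  ... | no Nn≮x = ⊥-elim (<⇒≱ n<⌈x/N⌉ (<⇒≤pred (m<n*o⇒m/o<n (begin-strict
    x + N′            ≤⟨ +-monoˡ-≤ N′ (≮⇒≥ Nn≮x) ⟩
    N * n + N′        <⟨ n<1+n _ ⟩
    suc (N * n + N′)  ≡⟨ solve 2 (λ n a → con 1 :+ ((con 1 :+ a) :* n :+ a) := (con 1 :+ n) :* (con 1 :+ a)) refl n N′ ⟩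
    suc n * N         ∎))))

-- Below n₀ = ⌈E/N⌉ both sides hold, above it both fail, so only f n₀ matters.
<-ceilDiv-threshold⇔ : ∀ N′ E (f : ℕ → ℕ) → (∀ n → f n ≤ suc N′) → ∀ n →
                       n < ceilDiv (E + f (ceilDiv E (suc N′))) (suc N′) ⇔ suc N′ * n < E + f n
<-ceilDiv-threshold⇔ N′ E f f≤N n with <-cmp n (ceilDiv E (suc N′))
... | tri< n<n₀ _ _ = mk⇔ (λ _ → below n<n₀ (f n)) (λ _ → from (<-ceilDiv⇔ N′ _ n) (below n<n₀ _))
  where
  N = suc N′
  open Equivalence
  below : n < ceilDiv E N → ∀ x → N * n < E + x
  below n<n₀ x = <-≤-trans (to (<-ceilDiv⇔ N′ E n) n<n₀) (m≤m+n E x)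
... | tri≈ _ refl _ = <-ceilDiv⇔ N′ _ n
... | tri> _ _ n₀<n = mk⇔ (λ n<F → ⊥-elim (above _ (to (<-ceilDiv⇔ N′ _ n) n<F)))
                          (λ Nn<E+fn → ⊥-elim (above _ Nn<E+fn))
  where
  N = suc N′
  n₀ = ceilDiv E N
  open Equivalence
  open ≤-Reasoning
  E≤Nn₀ : E ≤ N * n₀
  E≤Nn₀ with N * n₀ <? E
  ... | yes Nn₀<E = ⊥-elim (<-irrefl refl (from (<-ceilDiv⇔ N′ E n₀) Nn₀<E))
  ... | no Nn₀≮E = ≮⇒≥ Nn₀≮E
  above : ∀ m → ¬ (N * n < E + f m)
  above m Nn<E+fm = <-irrefl refl (begin-strict
    E + f m      ≤⟨ +-mono-≤ E≤Nn₀ (f≤N m) ⟩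
    N * n₀ + N   ≡⟨ trans (+-comm (N * n₀) N) (sym (*-suc N n₀)) ⟩
    N * suc n₀   ≤⟨ *-monoʳ-≤ N n₀<n ⟩
    N * n        <⟨ Nn<E+fm ⟩
    E + f m      ∎)

∸[∸]≡∸+ : ∀ {D δ r} → δ ≤ D → r ≤ δ → D ∸ (δ ∸ r) ≡ D ∸ δ + r
∸[∸]≡∸+ {D} {δ} {r} δ≤D r≤δ = begin
  D ∸ (δ ∸ r)              ≡⟨ cong (_∸ (δ ∸ r)) (m+[n∸m]≡n δ≤D) ⟨
  δ + (D ∸ δ) ∸ (δ ∸ r)    ≡⟨ cong (_∸ (δ ∸ r)) (+-comm δ (D ∸ δ)) ⟩
  D ∸ δ + δ ∸ (δ ∸ r)      ≡⟨ +-∸-assoc (D ∸ δ) (m∸n≤m δ r) ⟩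
  D ∸ δ + (δ ∸ (δ ∸ r))    ≡⟨ cong (D ∸ δ +_) (m∸[m∸n]≡n r≤δ) ⟩
  D ∸ δ + r                ∎
  where open ≡-Reasoning

modN≡% : ∀ x n .{{_ : NonZero n}} → modN x n ≡ x % n
modN≡% x (suc n) = refl

theorem8 : (d k l : ℕ) → 0 < d → 0 < l → l < k → IsGamma d k l (gammaFormula d k l)
theorem8 (suc d′) (suc k′) l _ _ l<k = attained _ ≤-refl , bounded
  where
  D = suc d′
  k = suc k′
  δ = gcd D (k ∸ l)
  instance
    δ≢0 : NonZero δ
    δ≢0 = ≢-nonZero (gcd[m,n]≢0 D (k ∸ l) (inj₁ (λ ())))
  δ≤D : δ ≤ D
  δ≤D = ∣⇒≤ (gcd[m,n]∣m D (k ∸ l))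
  n₀ = ceilDiv (D ∸ δ) (k + l)
  γ≡ : gammaFormula D k l ≡ ceilDiv (D ∸ δ + (l * n₀) % δ) (k + l)
  γ≡ = trans (cong (λ r → ceilDiv (D ∸ (δ ∸ r)) (k + l)) (modN≡% (l * n₀) δ))
             (cong (λ x → ceilDiv x (k + l)) (∸[∸]≡∸+ δ≤D (<⇒≤ (m%n<n (l * n₀) δ))))
  %δ≤k+l : ∀ n → (l * n) % δ ≤ k + l
  %δ≤k+l n = ≤-trans (<⇒≤ (m%n<n (l * n) δ))
    (≤-trans (gcd[m,n]≤n D (k ∸ l) {{>-nonZero (m<n⇒0<n∸m l<k)}}) (≤-trans (m∸n≤m k l) (m≤m+n k l)))
  n<γ⇔separating : ∀ n → n < gammaFormula D k l ⇔ SeparatingMultiple δ D k l n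
  n<γ⇔separating n = subst (λ γ → n < γ ⇔ SeparatingMultiple δ D k l n) (sym γ≡)
    (⇔-sym (separatingMultiple⇔ δ D k l n δ≤D) ⇔-∘ <-ceilDiv-threshold⇔ (k′ + l) (D ∸ δ) (λ m → (l * m) % δ) %δ≤k+l n)
  attained : ∀ m → m ≤ gammaFormula D k l → m ≡ 0 ⊎ SumFreeCoprimeAP D k l m
  attained zero    _   = inj₁ refl
  attained (suc n) n<γ = inj₂ (separatingMultiple⇒sumFreeCoprimeAP d′ l<k
                                 (Bézout.Identity.sym (Bézout.identity (gcd-GCD D (k ∸ l))))
                                 (Equivalence.to (n<γ⇔separating n) n<γ))
  bounded : ∀ m → SumFreeCoprimeAP D k l m → m ≤ gammaFormula D k l
  bounded (suc n) (a , b , _ , _ , gcd≡1 , _ , _ , sf) =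
    Equivalence.from (n<γ⇔separating n)
      (sumFree⇒separatingMultiple d′ {a = a} {b = b} (<⇒≤ l<k) (gcd[m,n]∣m D (k ∸ l)) (gcd[m,n]∣n D (k ∸ l)) gcd≡1 sf)
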